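{- Let $d\ge 3$, let $S$ be a multiset of non-negative integers, and let $G$ be a $d$-regular graph with girth larger than $3\max(S)$. Then the polygraph $G_S$ is $(a_S,b_S)$-regular, where the integers $a_S,b_S$ depend only on $S$ (and $d$), not on $G$.
   Context: With $\rho$ the graph metric of $G$ and $S=[l_1,\dots,l_m]$, $G_S$ has vertex set $V(G)^m$, and $(x_1,\dots,x_m)\sim(y_1,\dots,y_m)$ iff the multiset $[\rho(x_1,y_1),\dots,\rho(x_m,y_m)]$ equals $S$. The link of a vertex is the subgraph induced on its neighbours; a graph is $(a,b)$-regular if it is $a$-regular and every link is $b$-regular. -}

module Defs where

open import Data.Nat using (ℕ; zero; suc; _≤_; _<_; _⊔_)
open import Data.Fin using (Fin)
open import Data.List using (List; []; _∷_; _++_; [_]; length; foldr)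
open import Data.List.Membership.Propositional using (_∈_)
open import Data.List.Relation.Unary.Unique.Propositional using (Unique)
open import Data.List.Relation.Unary.Linked using (Linked)
open import Data.List.Relation.Binary.Permutation.Propositional using (_↭_)
open import Data.Vec using (Vec; lookup; toList)
open import Data.Product using (Σ; ∃; _×_)
open import Function.Bundles using (_⇔_)
open import Relation.Nullary using (¬_)
open import Relation.Binary.PropositionalEquality using (_≡_)
open import Data.Empty using (⊥)

record Graph : Set₁ where
  field
    n     : ℕ
    E     : Fin n → Fin n → Set
    sym   : ∀ {x y} → E x y → E y x
    irrefl : ∀ x → ¬ E x x
open Graph public

ExactlyN : {V : Set} → (V → Set) → ℕ → Set
ExactlyN {V} P a =
  Σ (List V) λ L → Unique L × length L ≡ a × (∀ y → (y ∈ L) ⇔ P y)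

IsRegular : {V : Set} → (V → V → Set) → ℕ → Set
IsRegular Adj a = ∀ x → ExactlyN (Adj x) a

-- every link (subgraph induced on the neighbourhood of x) is b-regular
LinksRegular : {V : Set} → (V → V → Set) → ℕ → Set
LinksRegular Adj b =
  ∀ x y → Adj x y → ExactlyN (λ z → Adj x z × Adj y z) b

IsABRegular : {V : Set} → (V → V → Set) → ℕ → ℕ → Set
IsABRegular Adj a b = IsRegular Adj a × LinksRegular Adj b

data Walk (G : Graph) : Fin (n G) → Fin (n G) → ℕ → Set where
  here  : ∀ x → Walk G x x zero
  step  : ∀ {x y z k} → E G x y → Walk G y z k → Walk G x z (suc k)

-- graph metric: ρ(x,y) = k  (undefined if x, y lie in different components)
Dist : (G : Graph) → Fin (n G) → Fin (n G) → ℕ → Set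
Dist G x y k = Walk G x y k × (∀ j → Walk G x y j → k ≤ j)

-- a cycle: distinct vertices v ∷ vs, at least 3 of them, consecutive ones
-- adjacent and the last adjacent to v (encoded by closing the list with v)
IsCycle : (G : Graph) → List (Fin (n G)) → Set
IsCycle G [] = ⊥
IsCycle G (v ∷ vs) =
  Unique (v ∷ vs) × 3 ≤ length (v ∷ vs) × Linked (E G) (v ∷ vs ++ [ v ])

-- girth(G) > g : every cycle has length > g (acyclic graphs have girth ∞)
GirthGreaterThan : Graph → ℕ → Set
GirthGreaterThan G g = ∀ c → IsCycle G c → g < length c

-- max of a multiset (0 for the empty one)
maxList : List ℕ → ℕ
maxList = foldr _⊔_ 0

PolyAdj : (G : Graph) (S : List ℕ) →
          Vec (Fin (n G)) (length S) → Vec (Fin (n G)) (length S) → Set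
PolyAdj G S xs ys =
  Σ (Vec ℕ (length S)) λ ds →
    (∀ i → Dist G (lookup xs i) (lookup ys i) (lookup ds i)) × (toList ds ↭ S)

-- Regularity of G_S and of its links means: for fixed X (resp. adjacent X, Y) the number
-- of Z whose coordinatewise distances to X (and to Y) form the multiset S is independent of
-- X (resp. X, Y). Choosing those distances one coordinate at a time expresses the count as a
-- sum over distance assignments, weighted by the numbers F l (p , q) of vertices at distance
-- p from x and q from y when x and y are at distance l, with l, p, q ≤ max S; reordering
-- this finite sum shows that only the multiset of distances between X and Y matters.
-- In a d-regular graph of girth > 3 max S, reduced words of length ≤ max S from a vertex x
-- name vertices injectively (two of them with the same endpoint would close a non-backtracking
-- walk of length ≤ 3 max S, which must contain a cycle that is too short), and the graph
-- distance between their endpoints is the distance in the d-regular tree. Hence F can be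
-- computed in the tree and depends only on d.

module Submission where

open import Defs hiding (sym)
open import Data.Empty using (⊥; ⊥-elim)
open import Data.Fin as Fin using (Fin; zero; suc; punchIn; punchOut)
open import Data.Fin.Properties using (punchIn-injective; punchInᵢ≢i; punchIn-punchOut)
open import Data.List as List using (List; []; _∷_; _++_; [_]; length; map; allFin; upTo; cartesianProduct)
open import Data.List.Properties
  using (∷-injectiveʳ; length-++; length-map; length-tabulate; ++-assoc; filter-all)
open import Data.List.Membership.Propositional using (_∈_; _∉_)
open import Data.List.Membership.Propositional.Properties
  using (∈-++⁺ˡ; ∈-++⁺ʳ; ∈-++⁻; ∈-map⁺; ∈-map⁻; ∈-allFin; ∈-lookup; ∈-∃++; ∈-filter⁺; ∈-filter⁻;
         ∈-upTo⁺; ∈-cartesianProduct⁺)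
open import Data.List.Relation.Binary.Permutation.Propositional
  using (_↭_; ↭-sym; prep; swap) renaming (refl to ↭-refl; trans to ↭-trans)
open import Data.List.Relation.Binary.Permutation.Propositional.Properties
  using (∈-resp-↭; drop-∷; ↭-empty-inv)
open import Data.List.Relation.Unary.All as All using (All; []; _∷_)
open import Data.List.Relation.Unary.Any using (here; there; index)
open import Data.List.Relation.Unary.Any.Properties using (lookup-index)
open import Data.List.Relation.Unary.Linked as Linked using (Linked; []; [-]; _∷_)
open import Data.List.Relation.Unary.Unique.Propositional using (Unique; []; _∷_)
import Data.List.Relation.Unary.Unique.Propositional.Properties as Unique
open import Data.Maybe using (Maybe; just; nothing)
open import Data.Nat using (ℕ; zero; suc; _+_; _*_; _∸_; _≤_; _<_; _≟_; z≤n; s≤s)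
open import Data.Nat.ListAction using (sum)
open import Data.Nat.Properties
  using (_≤?_; suc-injective; +-comm; +-assoc; +-suc; +-identityʳ; *-comm; *-identityʳ; *-zeroʳ; *-distribˡ-+;
         ≤-refl; ≤-reflexive; ≤-trans; ≤-antisym; ≤-pred; <-irrefl; <⇒≤; ≰⇒>; n≤1+n; m<n⇒m<1+n; m<m+n;
         m≤m+n; m≤n+m; +-monoˡ-≤; +-monoʳ-≤; +-mono-≤; m≤m⊔n; m≤n⊔m; module ≤-Reasoning)
open import Data.Nat.Tactic.RingSolver using (solve-∀)
open import Data.List.Membership.DecPropositional _≟_ using (_∈?_)
open import Data.Product using (Σ; ∃; _×_; _,_; proj₁; proj₂)
open import Data.Sum as Sum using (_⊎_; inj₁; inj₂)
open import Data.Unit using (⊤; tt)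
open import Data.Vec as Vec using (Vec; []; _∷_; lookup; toList)
open import Data.Vec.Properties using (lookup-replicate)
open import Function using (id; _∘_; _∘′_)
open import Function.Bundles using (_⇔_; mk⇔; Equivalence)
open import Relation.Binary.Definitions using (DecidableEquality)
open import Relation.Binary.PropositionalEquality
  using (_≡_; _≢_; refl; sym; trans; cong; cong₂; subst; module ≡-Reasoning)
open import Relation.Nullary using (¬_; ¬?; Dec; yes; no; contradiction)

open Equivalence using (to; from)

private
  variable
    A B I : Set
    P Q : A → Set
    a b k : ℕ

ExactlyN-cong : (∀ y → P y ⇔ Q y) → a ≡ b → ExactlyN P a → ExactlyN Q b
ExactlyN-cong P⇔Q refl (L , u , len , ∈⇔) =
  L , u , len , λ y → mk⇔ (to (P⇔Q y) ∘′ to (∈⇔ y)) (from (∈⇔ y) ∘′ from (P⇔Q y))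

ExactlyN-empty : (∀ y → ¬ P y) → ExactlyN P 0
ExactlyN-empty ¬P = [] , [] , refl , λ y → mk⇔ (λ ()) (⊥-elim ∘ ¬P y)

ExactlyN-singleton : (y₀ : A) → (∀ y → P y ⇔ y ≡ y₀) → ExactlyN P 1
ExactlyN-singleton y₀ P⇔≡ =
  [ y₀ ] , [] ∷ [] , refl , λ y → mk⇔ (λ { (here refl) → from (P⇔≡ y) refl }) (here ∘ to (P⇔≡ y))

ExactlyN-⊎ : (∀ {y} → P y → ¬ Q y) → ExactlyN P a → ExactlyN Q b →
             ExactlyN (λ y → P y ⊎ Q y) (a + b)
ExactlyN-⊎ P∩Q=∅ (L₁ , u₁ , refl , ∈⇔₁) (L₂ , u₂ , refl , ∈⇔₂) =
  L₁ ++ L₂ ,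
  Unique.++⁺ u₁ u₂ (λ (y∈₁ , y∈₂) → P∩Q=∅ (to (∈⇔₁ _) y∈₁) (to (∈⇔₂ _) y∈₂)) ,
  length-++ L₁ ,
  λ y → mk⇔ (Sum.map (to (∈⇔₁ y)) (to (∈⇔₂ y)) ∘ ∈-++⁻ L₁)
            (Sum.[ ∈-++⁺ˡ ∘ from (∈⇔₁ y) , ∈-++⁺ʳ L₁ ∘ from (∈⇔₂ y) ])

Unique-map⁺ : ∀ (f : A → B) {xs} → (∀ {x x'} → x ∈ xs → x' ∈ xs → f x ≡ f x' → x ≡ x') →
              Unique xs → Unique (map f xs)
Unique-map⁺ f injOn [] = []
Unique-map⁺ f {x ∷ xs} injOn (x∉xs ∷ u) =
  All.tabulate (λ fx'∈ fx≡fx' → let (x' , x'∈ , fx'≡) = ∈-map⁻ f fx'∈ in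
                 All.lookup x∉xs x'∈ (injOn (here refl) (there x'∈) (trans fx≡fx' fx'≡)))
  ∷ Unique-map⁺ f (λ x∈ x'∈ → injOn (there x∈) (there x'∈)) u

ExactlyN-image : (f : A → B) → (∀ {x x'} → P x → P x' → f x ≡ f x' → x ≡ x') →
                 (∀ y → Q y ⇔ ∃ λ x → P x × f x ≡ y) → ExactlyN P a → ExactlyN Q a
ExactlyN-image f injOn Q⇔img (L , u , len , ∈⇔) =
  map f L ,
  Unique-map⁺ f (λ x∈ x'∈ → injOn (to (∈⇔ _) x∈) (to (∈⇔ _) x'∈)) u ,
  trans (length-map f L) len ,
  λ y → mk⇔ (λ y∈ → let (x , x∈ , y≡) = ∈-map⁻ f y∈ in
                     from (Q⇔img y) (x , to (∈⇔ x) x∈ , sym y≡))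
            (λ Qy → let (x , Px , fx≡y) = to (Q⇔img y) Qy in
                    subst (_∈ map f L) fx≡y (∈-map⁺ f (from (∈⇔ x) Px)))

∑ : List A → (A → ℕ) → ℕ
∑ xs f = sum (map f xs)

infix 5 ∑
syntax ∑ xs (λ x → e) = ∑[ x ∈ xs ] e

ExactlyN-⋃ : {P : I → A → Set} {size : I → ℕ} (is : List I) → Unique is →
             (∀ {i j y} → P i y → P j y → i ≡ j) → (∀ {i} → i ∈ is → ExactlyN (P i) (size i)) →
             ExactlyN (λ y → ∃ λ i → i ∈ is × P i y) (∑ is size)
ExactlyN-⋃ [] _ _ _ = ExactlyN-empty (λ { y (_ , () , _) })
ExactlyN-⋃ {P = P} (i ∷ is) (i∉is ∷ u) disjoint count =
  ExactlyN-cong split refl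
    (ExactlyN-⊎ (λ { Piy (j , j∈ , Pjy) → All.lookup i∉is j∈ (disjoint Piy Pjy) })
                (count (here refl)) (ExactlyN-⋃ is u disjoint (count ∘ there)))
  where
  split : ∀ y → (P i y ⊎ ∃ λ j → j ∈ is × P j y) ⇔ (∃ λ j → j ∈ i ∷ is × P j y)
  split y = mk⇔ (λ { (inj₁ Piy) → i , here refl , Piy ; (inj₂ (j , j∈ , Pjy)) → j , there j∈ , Pjy })
                (λ { (j , here refl , Pjy) → inj₁ Pjy ; (j , there j∈ , Pjy) → inj₂ (j , j∈ , Pjy) })

∑-const : ∀ (xs : List A) → ∑ xs (λ _ → b) ≡ length xs * b
∑-const [] = refl
∑-const {b = b} (x ∷ xs) = cong (b +_) (∑-const xs)

ExactlyN-Σ : {Q : A → B → Set} → ExactlyN P a → (∀ {x} → P x → ExactlyN (Q x) b) →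
             ExactlyN (λ (xy : A × B) → P (proj₁ xy) × Q (proj₁ xy) (proj₂ xy)) (a * b)
ExactlyN-Σ {P = P} {b = b} {Q = Q} (L , u , refl , ∈⇔) count =
  ExactlyN-cong flatten (∑-const L)
    (ExactlyN-⋃ L u (λ { (refl , _) (refl , _) → refl }) (λ x∈ → fibre (to (∈⇔ _) x∈)))
  where
  Fibre : _ → _ × _ → Set
  Fibre x (x' , y) = x ≡ x' × Q x y
  fibre : ∀ {x} → P x → ExactlyN (Fibre x) b
  fibre {x} Px = ExactlyN-image (x ,_) (λ _ _ → cong proj₂)
    (λ { (x' , y) → mk⇔ (λ { (refl , Qxy) → y , Qxy , refl }) (λ { (_ , Qxy , refl) → refl , Qxy }) })
    (count Px)
  flatten : ∀ xy → (∃ λ x → x ∈ L × Fibre x xy) ⇔ (P (proj₁ xy) × Q (proj₁ xy) (proj₂ xy))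
  flatten (x , y) = mk⇔ (λ { (_ , x∈ , refl , Qxy) → to (∈⇔ x) x∈ , Qxy })
                        (λ (Px , Qxy) → x , from (∈⇔ x) Px , refl , Qxy)

_◃_ : (A → Set) → (A → List A → Set) → List A → Set
(P ◃ Q) []       = ⊥
(P ◃ Q) (x ∷ xs) = P x × Q x xs

ExactlyN-◃ : {Q : A → List A → Set} → ExactlyN P a → (∀ {x} → P x → ExactlyN (Q x) b) →
             ExactlyN (P ◃ Q) (a * b)
ExactlyN-◃ countP countQ = ExactlyN-image (λ (x , xs) → x ∷ xs) (λ { _ _ refl → refl })
  (λ { []       → mk⇔ (λ ()) (λ { (_ , _ , ()) })
     ; (x ∷ xs) → mk⇔ (λ PQ → (x , xs) , PQ , refl) (λ { (_ , PQ , refl) → PQ }) })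
  (ExactlyN-Σ countP countQ)

ExactlyN-Fin : ExactlyN (λ (_ : Fin k) → ⊤) k
ExactlyN-Fin {k} = allFin k , Unique.allFin⁺ k , length-tabulate _ , λ i → mk⇔ _ (λ _ → ∈-allFin i)

ExactlyN-≢ : (i : Fin k) → ExactlyN (_≢ i) (k ∸ 1)
ExactlyN-≢ {suc k} i = ExactlyN-image (punchIn i) (λ _ _ → punchIn-injective i _ _)
  (λ j → mk⇔ (λ j≢i → punchOut (j≢i ∘ sym) , tt , punchIn-punchOut _)
             (λ { (j' , _ , refl) → punchInᵢ≢i i j' }))
  ExactlyN-Fin

module _ (_≟ᴬ_ : DecidableEquality A) {y₀ : A} where

  private
    ≢y₀? : ∀ y → Dec (y ≢ y₀)
    ≢y₀? y = ¬? (y ≟ᴬ y₀)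

    length-filter-≢ : ∀ xs → Unique xs → y₀ ∈ xs → length (List.filter ≢y₀? xs) ≡ length xs ∸ 1
    length-filter-≢ (x ∷ xs) (x∉ ∷ u) y₀∈ with x ≟ᴬ y₀ | y₀∈
    ... | yes refl | _          = cong length (filter-all ≢y₀? (All.map (_∘ sym) x∉))
    ... | no  x≢y₀ | here refl  = contradiction refl x≢y₀
    ... | no  _    | there y₀∈xs = trans (cong suc (length-filter-≢ xs u y₀∈xs)) (nonEmpty y₀∈xs)
      where
      nonEmpty : ∀ {y ys} → y ∈ ys → suc (length ys ∸ 1) ≡ length ys
      nonEmpty (here _)  = refl
      nonEmpty (there _) = refl

  ExactlyN-remove : ExactlyN P a → P y₀ → ExactlyN (λ y → P y × y ≢ y₀) (a ∸ 1)
  ExactlyN-remove (L , u , refl , ∈⇔) Py₀ =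
    List.filter ≢y₀? L ,
    Unique.filter⁺ ≢y₀? u ,
    length-filter-≢ L u (from (∈⇔ y₀) Py₀) ,
    λ y → mk⇔ (λ y∈ → let (y∈L , y≢y₀) = ∈-filter⁻ ≢y₀? y∈ in to (∈⇔ y) y∈L , y≢y₀)
              (λ (Py , y≢y₀) → ∈-filter⁺ ≢y₀? (from (∈⇔ y) Py) y≢y₀)

enumerate : {P : A → Set} → ExactlyN P a → Fin a → A
enumerate (L , _ , refl , _) = List.lookup L

enumerate-sound : (count : ExactlyN P a) → ∀ i → P (enumerate count i)
enumerate-sound (L , _ , refl , ∈⇔) i = to (∈⇔ _) (∈-lookup i)

enumerate-injective : (count : ExactlyN P a) → ∀ i j → enumerate count i ≡ enumerate count j → i ≡ j
enumerate-injective (L , u , refl , _) = lookup-injective u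
  where
  lookup-injective : ∀ {xs : List A} → Unique xs → ∀ i j → List.lookup xs i ≡ List.lookup xs j → i ≡ j
  lookup-injective (_  ∷ _) zero    zero    _  = refl
  lookup-injective (x∉ ∷ _) zero    (suc j) eq = contradiction eq (All.lookup x∉ (∈-lookup j))
  lookup-injective (x∉ ∷ _) (suc i) zero    eq = contradiction (sym eq) (All.lookup x∉ (∈-lookup i))
  lookup-injective (_  ∷ u) (suc i) (suc j) eq = cong suc (lookup-injective u i j eq)

enumerate-surjective : (count : ExactlyN P a) → ∀ {y} → P y → ∃ λ i → enumerate count i ≡ y
enumerate-surjective (L , _ , refl , ∈⇔) {y} Py = index y∈ , sym (lookup-index y∈)
  where
  y∈ : y ∈ L
  y∈ = from (∈⇔ y) Py

∑-cong : ∀ (xs : List A) {f g : A → ℕ} → (∀ x → f x ≡ g x) → ∑ xs f ≡ ∑ xs g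
∑-cong []       f≗g = refl
∑-cong (x ∷ xs) f≗g = cong₂ _+_ (f≗g x) (∑-cong xs f≗g)

∑-zero : ∀ (xs : List A) → ∑ xs (λ _ → 0) ≡ 0
∑-zero xs = trans (∑-const xs) (*-zeroʳ (length xs))

∑-+ : ∀ (xs : List A) (f g : A → ℕ) → ∑ xs (λ x → f x + g x) ≡ ∑ xs f + ∑ xs g
∑-+ []       f g = refl
∑-+ (x ∷ xs) f g = trans (cong (f x + g x +_) (∑-+ xs f g)) (+-+-interchange (f x) (g x) _ _)
  where
  +-+-interchange : ∀ a b c d → a + b + (c + d) ≡ a + c + (b + d)
  +-+-interchange = solve-∀

*-distribˡ-∑ : ∀ c (xs : List A) (f : A → ℕ) → c * ∑ xs f ≡ ∑ xs (λ x → c * f x)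
*-distribˡ-∑ c []       f = *-zeroʳ c
*-distribˡ-∑ c (x ∷ xs) f = trans (*-distribˡ-+ c (f x) _) (cong (c * f x +_) (*-distribˡ-∑ c xs f))

∑-comm : ∀ (xs : List A) (ys : List B) (h : A → B → ℕ) →
         ∑[ x ∈ xs ] ∑[ y ∈ ys ] h x y ≡ ∑[ y ∈ ys ] ∑[ x ∈ xs ] h x y
∑-comm []       ys h = sym (∑-zero ys)
∑-comm (x ∷ xs) ys h = trans (cong (∑ ys (h x) +_) (∑-comm xs ys h)) (sym (∑-+ ys (h x) _))

delete : ℕ → List ℕ → List ℕ
delete e []      = []
delete e (x ∷ T) with x ≟ e
... | yes _ = T
... | no  _ = x ∷ delete e T

delete-head : ∀ e T → delete e (e ∷ T) ≡ T
delete-head e T with e ≟ e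
... | yes _   = refl
... | no  e≢e = contradiction refl e≢e

delete-skip : ∀ {x e} T → x ≢ e → delete e (x ∷ T) ≡ x ∷ delete e T
delete-skip {x} {e} T x≢e with x ≟ e
... | yes x≡e = contradiction x≡e x≢e
... | no  _   = refl

delete-comm : ∀ p q T → delete p (delete q T) ≡ delete q (delete p T)
delete-comm p q []      = refl
delete-comm p q (x ∷ T) with x ≟ q | x ≟ p
... | yes refl | yes refl = refl
... | yes refl | no  x≢p  = sym (delete-head x (delete p T))
... | no  x≢q  | yes refl = delete-head x (delete q T)
... | no  x≢q  | no  x≢p  = begin
  delete p (x ∷ delete q T)  ≡⟨ delete-skip _ x≢p ⟩
  x ∷ delete p (delete q T)  ≡⟨ cong (x ∷_) (delete-comm p q T) ⟩
  x ∷ delete q (delete p T)  ≡⟨ delete-skip _ x≢q ⟨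
  delete q (x ∷ delete p T)  ∎
  where open ≡-Reasoning

↭-delete : ∀ {e T} → e ∈ T → T ↭ e ∷ delete e T
↭-delete {e} {x ∷ T} e∈ with x ≟ e | e∈
... | yes refl | _          = ↭-refl
... | no  x≢e  | here refl  = contradiction refl x≢e
... | no  _    | there e∈T = ↭-trans (prep x (↭-delete e∈T)) (swap x e ↭-refl)

∈-delete⁻ : ∀ {y} e T → y ∈ delete e T → y ∈ T
∈-delete⁻ e (x ∷ T) y∈ with x ≟ e
... | yes _ = there y∈
∈-delete⁻ e (x ∷ T) (here refl)  | no _ = here refl
∈-delete⁻ e (x ∷ T) (there y∈T) | no _ = there (∈-delete⁻ e T y∈T)

∈-delete⁺ : ∀ {y e T} → y ≢ e → y ∈ T → y ∈ delete e T
∈-delete⁺ {y} {e} {x ∷ T} y≢e y∈ with x ≟ e | y∈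
... | yes refl | here refl  = contradiction refl y≢e
... | yes _    | there y∈T = y∈T
... | no  _    | here refl  = here refl
... | no  _    | there y∈T = there (∈-delete⁺ y≢e y∈T)

𝟙 : {X : Set} → Dec X → ℕ
𝟙 (yes _) = 1
𝟙 (no  _) = 0

𝟙-cong : {X Y : Set} → X ⇔ Y → (x? : Dec X) (y? : Dec Y) → 𝟙 x? ≡ 𝟙 y?
𝟙-cong X⇔Y (yes _) (yes _) = refl
𝟙-cong X⇔Y (no  _) (no  _) = refl
𝟙-cong X⇔Y (yes x) (no ¬y) = contradiction (to X⇔Y x) ¬y
𝟙-cong X⇔Y (no ¬x) (yes y) = contradiction (from X⇔Y y) ¬x

ExactlyN-guard : {X : Set} (X? : Dec X) → ExactlyN P a → ExactlyN (λ y → P y × X) (𝟙 X? * a)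
ExactlyN-guard (yes x) count = ExactlyN-cong (λ y → mk⇔ (_, x) proj₁) (sym (+-identityʳ _)) count
ExactlyN-guard (no ¬x) count = ExactlyN-empty (λ y → ¬x ∘ proj₂)

𝟙∈-delete-swap : ∀ p p' T →
                 𝟙 (p ∈? T) * 𝟙 (p' ∈? delete p T) ≡ 𝟙 (p' ∈? T) * 𝟙 (p ∈? delete p' T)
𝟙∈-delete-swap p p' T with p ≟ p'
... | yes refl = refl
... | no  p≢p' = begin
  𝟙 (p ∈? T) * 𝟙 (p' ∈? delete p T)   ≡⟨ cong₂ _*_ (𝟙-cong p∈⇔ (p ∈? T) (p ∈? delete p' T))
                                                    (𝟙-cong p'∈⇔ (p' ∈? delete p T) (p' ∈? T)) ⟩
  𝟙 (p ∈? delete p' T) * 𝟙 (p' ∈? T)   ≡⟨ *-comm (𝟙 (p ∈? delete p' T)) _ ⟩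
  𝟙 (p' ∈? T) * 𝟙 (p ∈? delete p' T)   ∎
  where
  open ≡-Reasoning
  p∈⇔ : p ∈ T ⇔ p ∈ delete p' T
  p∈⇔ = mk⇔ (∈-delete⁺ p≢p') (∈-delete⁻ p' T)
  p'∈⇔ : p' ∈ delete p T ⇔ p' ∈ T
  p'∈⇔ = mk⇔ (∈-delete⁻ p T) (∈-delete⁺ (p≢p' ∘ sym))

Multiset² : Set
Multiset² = List ℕ × List ℕ

𝟙∈² : ℕ × ℕ → Multiset² → ℕ
𝟙∈² (p , q) (T₁ , T₂) = 𝟙 (p ∈? T₁) * 𝟙 (q ∈? T₂)

infixl 20 _∖_

_∖_ : Multiset² → ℕ × ℕ → Multiset²
(T₁ , T₂) ∖ (p , q) = delete p T₁ , delete q T₂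

∖-comm : ∀ T π π' → T ∖ π ∖ π' ≡ T ∖ π' ∖ π
∖-comm (T₁ , T₂) (p , q) (p' , q') = cong₂ _,_ (delete-comm p' p T₁) (delete-comm q' q T₂)

𝟙∈²-swap : ∀ T π π' → 𝟙∈² π T * 𝟙∈² π' (T ∖ π) ≡ 𝟙∈² π' T * 𝟙∈² π (T ∖ π')
𝟙∈²-swap (T₁ , T₂) (p , q) (p' , q') = begin
  (𝟙 (p ∈? T₁) * 𝟙 (q ∈? T₂)) * (𝟙 (p' ∈? delete p T₁) * 𝟙 (q' ∈? delete q T₂))
    ≡⟨ interchange (𝟙 (p ∈? T₁)) _ _ _ ⟩
  (𝟙 (p ∈? T₁) * 𝟙 (p' ∈? delete p T₁)) * (𝟙 (q ∈? T₂) * 𝟙 (q' ∈? delete q T₂))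
    ≡⟨ cong₂ _*_ (𝟙∈-delete-swap p p' T₁) (𝟙∈-delete-swap q q' T₂) ⟩
  (𝟙 (p' ∈? T₁) * 𝟙 (p ∈? delete p' T₁)) * (𝟙 (q' ∈? T₂) * 𝟙 (q ∈? delete q' T₂))
    ≡⟨ interchange (𝟙 (p' ∈? T₁)) _ _ _ ⟩
  (𝟙 (p' ∈? T₁) * 𝟙 (q' ∈? T₂)) * (𝟙 (p ∈? delete p' T₁) * 𝟙 (q ∈? delete q' T₂))  ∎
  where
  open ≡-Reasoning
  interchange : ∀ a b c d → a * b * (c * d) ≡ a * c * (b * d)
  interchange = solve-∀

module CommonCount (M : ℕ) (F : ℕ → ℕ × ℕ → ℕ) where

  Radii : List ℕ
  Radii = upTo (suc M)

  Radii² : List (ℕ × ℕ)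
  Radii² = cartesianProduct Radii Radii

  -- commonCount ls (T₁ , T₂) is the number of Z with profiles T₁ from X and T₂ from Y when
  -- ls is the profile of (X , Y), provided F l (p , q) points lie at distances p and q from
  -- any two points at distance l.
  commonCount : List ℕ → Multiset² → ℕ
  commonCount []       ([] , []) = 1
  commonCount []       _         = 0
  commonCount (l ∷ ls) T         = ∑[ π ∈ Radii² ] 𝟙∈² π T * (F l π * commonCount ls (T ∖ π))

  commonCount-∷ : ∀ l {ls ls'} → (∀ T → commonCount ls T ≡ commonCount ls' T) →
                  ∀ T → commonCount (l ∷ ls) T ≡ commonCount (l ∷ ls') T
  commonCount-∷ l ls≗ls' T =
    ∑-cong Radii² (λ π → cong (λ c → 𝟙∈² π T * (F l π * c)) (ls≗ls' (T ∖ π)))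

  private
    term : ℕ → ℕ → List ℕ → Multiset² → ℕ × ℕ → ℕ × ℕ → ℕ
    term a b r T π π' = (𝟙∈² π T * 𝟙∈² π' (T ∖ π)) * ((F a π * F b π') * commonCount r (T ∖ π ∖ π'))

    expand : ∀ a b r T →
             commonCount (a ∷ b ∷ r) T ≡ ∑[ π ∈ Radii² ] ∑[ π' ∈ Radii² ] term a b r T π π'
    expand a b r T = ∑-cong Radii² λ π →
      trans (reassocˡ (𝟙∈² π T) (F a π) _) (trans (*-distribˡ-∑ (𝟙∈² π T * F a π) Radii² _)
            (∑-cong Radii² λ π' → reassocʳ (𝟙∈² π T) (F a π) (𝟙∈² π' (T ∖ π)) _ _))
      where
      reassocˡ : ∀ w f s → w * (f * s) ≡ (w * f) * s
      reassocˡ = solve-∀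
      reassocʳ : ∀ w f w' f' c → (w * f) * (w' * (f' * c)) ≡ (w * w') * ((f * f') * c)
      reassocʳ = solve-∀

    term-swap : ∀ a b r T π π' → term a b r T π π' ≡ term b a r T π' π
    term-swap a b r T π π' =
      cong₂ _*_ (𝟙∈²-swap T π π') (cong₂ _*_ (*-comm (F a π) _) (cong (commonCount r) (∖-comm T π π')))

  commonCount-swap : ∀ a b r T → commonCount (a ∷ b ∷ r) T ≡ commonCount (b ∷ a ∷ r) T
  commonCount-swap a b r T = begin
    commonCount (a ∷ b ∷ r) T                              ≡⟨ expand a b r T ⟩
    ∑[ π ∈ Radii² ] ∑[ π' ∈ Radii² ] term a b r T π π'     ≡⟨ ∑-comm Radii² Radii² _ ⟩
    ∑[ π' ∈ Radii² ] ∑[ π ∈ Radii² ] term a b r T π π'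
      ≡⟨ ∑-cong Radii² (λ π' → ∑-cong Radii² (λ π → term-swap a b r T π π')) ⟩
    ∑[ π' ∈ Radii² ] ∑[ π ∈ Radii² ] term b a r T π' π     ≡⟨ expand b a r T ⟨
    commonCount (b ∷ a ∷ r) T                              ∎
    where open ≡-Reasoning

  commonCount-↭ : ∀ {ls ls'} → ls ↭ ls' → ∀ T → commonCount ls T ≡ commonCount ls' T
  commonCount-↭ ↭-refl                 T = refl
  commonCount-↭ (prep {xs} {ys} l p)   T = commonCount-∷ l {xs} {ys} (commonCount-↭ p) T
  commonCount-↭ (swap {xs} {ys} a b p) T = trans (commonCount-swap a b xs T)
    (commonCount-∷ b {a ∷ xs} {a ∷ ys} (commonCount-∷ a {xs} {ys} (commonCount-↭ p)) T)
  commonCount-↭ (↭-trans p p')         T = trans (commonCount-↭ p T) (commonCount-↭ p' T)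

record DistanceRegularUpTo {V : Set} (R : V → V → ℕ → Set) (M : ℕ) (F : ℕ → ℕ × ℕ → ℕ) : Set where
  field
    functional   : ∀ {x y k k'} → R x y k → R x y k' → k ≡ k'
    reflexive    : ∀ x → R x x 0
    intersection : ∀ {x y l} → R x y l → l ≤ M → ∀ {p q} → p ≤ M → q ≤ M →
                   ExactlyN (λ z → R x z p × R y z q) (F l (p , q))

ExactlyN-∷ : {P : A → Set} {Q : Vec A k → Set} → ExactlyN P a → ExactlyN Q b →
             ExactlyN (λ (Z : Vec A (suc k)) → P (Vec.head Z) × Q (Vec.tail Z)) (a * b)
ExactlyN-∷ countP countQ = ExactlyN-image (λ (z , Z) → z ∷ Z) (λ { _ _ refl → refl })
  (λ { (z ∷ Z) → mk⇔ (λ PQ → (z , Z) , PQ , refl) (λ { (_ , PQ , refl) → PQ }) })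
  (ExactlyN-Σ countP (λ _ → countQ))

module Polygraph {V : Set} (R : V → V → ℕ → Set) where

  Profile : Vec V k → List ℕ → Vec V k → Set
  Profile {k} X T Z = Σ (Vec ℕ k) λ ds → (∀ i → R (lookup X i) (lookup Z i) (lookup ds i)) × (toList ds ↭ T)

  Profileᵣ : Vec V k → List ℕ → Vec V k → Set
  Profileᵣ []      T []      = T ≡ []
  Profileᵣ (x ∷ X) T (z ∷ Z) = ∃ λ e → e ∈ T × R x z e × Profileᵣ X (delete e T) Z

  Profile⇒Profileᵣ : ∀ (X : Vec V k) {T} Z → Profile X T Z → Profileᵣ X T Z
  Profile⇒Profileᵣ []      []      ([] , _ , ↭T) = ↭-empty-inv (↭-sym ↭T)
  Profile⇒Profileᵣ (x ∷ X) {T} (z ∷ Z) (e ∷ ds , R-ds , ↭T) =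
    e , e∈T , R-ds zero , Profile⇒Profileᵣ X Z (ds , R-ds ∘ suc , drop-∷ (↭-trans ↭T (↭-delete e∈T)))
    where
    e∈T : e ∈ T
    e∈T = ∈-resp-↭ ↭T (here refl)

  Profileᵣ⇒Profile : ∀ (X : Vec V k) {T} Z → Profileᵣ X T Z → Profile X T Z
  Profileᵣ⇒Profile []      []      refl = [] , (λ ()) , ↭-refl
  Profileᵣ⇒Profile (x ∷ X) (z ∷ Z) (e , e∈T , Rxze , rest) with Profileᵣ⇒Profile X Z rest
  ... | ds , R-ds , ↭T =
    e ∷ ds , (λ { zero → Rxze ; (suc i) → R-ds i }) , ↭-trans (prep e ↭T) (↭-sym (↭-delete e∈T))

  module _ {M F} (dreg : DistanceRegularUpTo R M F) where
    open DistanceRegularUpTo dreg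
    open CommonCount M F

    private
      Bounded : List ℕ → Set
      Bounded = All (_≤ M)

      ∈Radii : ∀ {e T} → Bounded T → e ∈ T → e ∈ Radii
      ∈Radii T≤M e∈T = ∈-upTo⁺ (s≤s (All.lookup T≤M e∈T))

      Radii²-unique : Unique Radii²
      Radii²-unique = Unique.cartesianProduct⁺ (Unique.upTo⁺ (suc M)) (Unique.upTo⁺ (suc M))

      Bounded-delete : ∀ {e T} → Bounded T → Bounded (delete e T)
      Bounded-delete {e} {T} T≤M = All.tabulate (All.lookup T≤M ∘ ∈-delete⁻ e T)

      Common : Vec V k → Vec V k → Multiset² → Vec V k → Set
      Common X Y (T₁ , T₂) Z = Profileᵣ X T₁ Z × Profileᵣ Y T₂ Z

      Piece : V → V → Vec V k → Vec V k → Multiset² → ℕ × ℕ → Vec V (suc k) → Set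
      Piece x y X Y (T₁ , T₂) (p , q) (z ∷ Z) =
        (p ∈ T₁ × q ∈ T₂) × (R x z p × R y z q) × Common X Y (delete p T₁ , delete q T₂) Z

    countCommon : ∀ {k} {X Y : Vec V k} {ls} → (∀ i → R (lookup X i) (lookup Y i) (lookup ls i)) →
                  Bounded (toList ls) → ∀ {T₁ T₂} → Bounded T₁ → Bounded T₂ →
                  ExactlyN (Common X Y (T₁ , T₂)) (commonCount (toList ls) (T₁ , T₂))
    countCommon {X = []} {[]} {[]} _ _ {[]}    {[]}    _ _ =
      ExactlyN-singleton [] (λ { [] → mk⇔ (λ _ → refl) (λ _ → refl , refl) })
    countCommon {X = []} {[]} {[]} _ _ {[]}    {_ ∷ _} _ _ = ExactlyN-empty (λ { [] (_ , ()) })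
    countCommon {X = []} {[]} {[]} _ _ {_ ∷ _} {_}     _ _ = ExactlyN-empty (λ { [] (() , _) })
    countCommon {X = x ∷ X} {y ∷ Y} {l ∷ ls} R-ls (l≤M ∷ ls≤M) {T₁} {T₂} T₁≤M T₂≤M =
      ExactlyN-cong split refl (ExactlyN-⋃ Radii² Radii²-unique disjoint countPiece)
      where
      countPiece : ∀ {π} → π ∈ Radii² →
                   ExactlyN (Piece x y X Y (T₁ , T₂) π)
                            (𝟙∈² π (T₁ , T₂) * (F l π * commonCount (toList ls) ((T₁ , T₂) ∖ π)))
      countPiece {p , q} _ with p ∈? T₁ | q ∈? T₂
      ... | yes p∈ | yes q∈ = ExactlyN-cong
          (λ { (z ∷ Z) → mk⇔ (λ (Rs , C) → (p∈ , q∈) , Rs , C) proj₂ })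
          (sym (+-identityʳ _))
          (ExactlyN-∷ (intersection (R-ls zero) l≤M (All.lookup T₁≤M p∈) (All.lookup T₂≤M q∈))
                      (countCommon (R-ls ∘ suc) ls≤M (Bounded-delete T₁≤M) (Bounded-delete T₂≤M)))
      ... | yes _  | no q∉  = ExactlyN-empty (λ { (z ∷ Z) ((_ , q∈) , _) → q∉ q∈ })
      ... | no p∉  | _      = ExactlyN-empty (λ { (z ∷ Z) ((p∈ , _) , _) → p∉ p∈ })
      disjoint : ∀ {π π' W} → Piece x y X Y (T₁ , T₂) π W → Piece x y X Y (T₁ , T₂) π' W → π ≡ π'
      disjoint {W = z ∷ Z} (_ , (Rxz , Ryz) , _) (_ , (Rxz' , Ryz') , _) =
        cong₂ _,_ (functional Rxz Rxz') (functional Ryz Ryz')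
      split : ∀ W → (∃ λ π → π ∈ Radii² × Piece x y X Y (T₁ , T₂) π W) ⇔
                    Common (x ∷ X) (y ∷ Y) (T₁ , T₂) W
      split (z ∷ Z) = mk⇔
        (λ { ((p , q) , _ , (p∈ , q∈) , (Rxz , Ryz) , (C₁ , C₂)) →
               (p , p∈ , Rxz , C₁) , (q , q∈ , Ryz , C₂) })
        (λ { ((p , p∈ , Rxz , C₁) , (q , q∈ , Ryz , C₂)) →
               (p , q) , ∈-cartesianProduct⁺ (∈Radii T₁≤M p∈) (∈Radii T₂≤M q∈) ,
               (p∈ , q∈) , (Rxz , Ryz) , (C₁ , C₂) })

    polygraph-regular : ∀ S → Bounded S →
      IsABRegular (λ (X Z : Vec V (length S)) → Profile X S Z)
                  (commonCount (toList (Vec.replicate (length S) 0)) (S , S)) (commonCount S (S , S))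
    polygraph-regular S S≤M = regular , linksRegular
      where
      Profile⇔Profileᵣ : ∀ X Z → Profile X S Z ⇔ Profileᵣ X S Z
      Profile⇔Profileᵣ X Z = mk⇔ (Profile⇒Profileᵣ X Z) (Profileᵣ⇒Profile X Z)
      regular : IsRegular (λ X Z → Profile X S Z) _
      regular X = ExactlyN-cong
        (λ Z → mk⇔ (from (Profile⇔Profileᵣ X Z) ∘ proj₁) (λ P → let Pᵣ = to (Profile⇔Profileᵣ X Z) P in Pᵣ , Pᵣ))
        refl (countCommon R-zeros (zeros-bounded (length S)) S≤M S≤M)
        where
        R-zeros : ∀ i → R (lookup X i) (lookup X i) (lookup (Vec.replicate (length S) 0) i)
        R-zeros i = subst (R _ _) (sym (lookup-replicate i 0)) (reflexive _)
        zeros-bounded : ∀ k → Bounded (toList (Vec.replicate k 0))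
        zeros-bounded zero    = []
        zeros-bounded (suc k) = z≤n ∷ zeros-bounded k
      linksRegular : LinksRegular (λ X Z → Profile X S Z) _
      linksRegular X Y (ls , R-ls , ls↭S) = ExactlyN-cong
        (λ Z → mk⇔ (λ (C₁ , C₂) → from (Profile⇔Profileᵣ X Z) C₁ , from (Profile⇔Profileᵣ Y Z) C₂)
                   (λ (P₁ , P₂) → to (Profile⇔Profileᵣ X Z) P₁ , to (Profile⇔Profileᵣ Y Z) P₂))
        (commonCount-↭ ls↭S (S , S))
        (countCommon R-ls (All.tabulate (All.lookup S≤M ∘ ∈-resp-↭ ls↭S)) S≤M S≤M)

module Walks (G : Graph) where

  private
    V = Fin (Graph.n G)
    open import Data.List.Membership.DecPropositional (Fin._≟_ {Graph.n G}) using () renaming (_∈?_ to _∈ⱽ?_)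

  _++ʷ_ : ∀ {x y z j k} → Walk G x y j → Walk G y z k → Walk G x z (j + k)
  here _   ++ʷ q = q
  step e p ++ʷ q = step e (p ++ʷ q)

  reverseʷ : ∀ {x y k} → Walk G x y k → Walk G y x k
  reverseʷ (here x)           = here x
  reverseʷ (step {k = k} e p) = subst (Walk G _ _) (+-comm k 1) (reverseʷ p ++ʷ step (Graph.sym G e) (here _))

  Dist-functional : ∀ {x y k k'} → Dist G x y k → Dist G x y k' → k ≡ k'
  Dist-functional (p , p-min) (q , q-min) = ≤-antisym (p-min _ q) (q-min _ p)

  Dist-refl : ∀ x → Dist G x x 0
  Dist-refl x = here x , λ _ _ → z≤n

  NonBacktracking : List V → Set
  NonBacktracking (a ∷ b ∷ c ∷ r) = a ≢ c × NonBacktracking (b ∷ c ∷ r)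
  NonBacktracking _               = ⊤

  NonBacktracking-tail : ∀ {x} xs → NonBacktracking (x ∷ xs) → NonBacktracking xs
  NonBacktracking-tail []          _        = tt
  NonBacktracking-tail (_ ∷ [])    _        = tt
  NonBacktracking-tail (_ ∷ _ ∷ _) (_ , nb) = nb

  private
    Unique-++⁻ˡ : ∀ (xs : List V) {ys} → Unique (xs ++ ys) → Unique xs
    Unique-++⁻ˡ []       _          = []
    Unique-++⁻ˡ (x ∷ xs) (x∉ ∷ u) = All.tabulate (All.lookup x∉ ∘ ∈-++⁺ˡ) ∷ Unique-++⁻ˡ xs u

    Unique-++-∉ˡ : ∀ (xs : List V) {x ys} → Unique (xs ++ x ∷ ys) → x ∉ xs
    Unique-++-∉ˡ (y ∷ xs) (y∉ ∷ _) (here refl) = All.lookup y∉ (∈-++⁺ʳ xs (here refl)) refl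
    Unique-++-∉ˡ (y ∷ xs) (_  ∷ u) (there x∈)  = Unique-++-∉ˡ xs u x∈

    Linked-++⁻ˡ : ∀ {R : V → V → Set} xs {ys} → Linked R (xs ++ ys) → Linked R xs
    Linked-++⁻ˡ []           _          = []
    Linked-++⁻ˡ (x ∷ [])     _          = [-]
    Linked-++⁻ˡ (x ∷ y ∷ xs) (Rxy ∷ lk) = Rxy ∷ Linked-++⁻ˡ (y ∷ xs) lk

  -- If the tail is duplicate-free but contains the head x, the segment from x back to x
  -- is a cycle; being non-backtracking rules out lengths 1 and 2.
  cycle-or-unique : ∀ xs → Linked (E G) xs → NonBacktracking xs →
                    Unique xs ⊎ ∃ λ c → IsCycle G c × length c < length xs
  cycle-or-unique []       _  _  = inj₁ []
  cycle-or-unique (x ∷ xs) lk nb with cycle-or-unique xs (Linked.tail lk) (NonBacktracking-tail xs nb)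
  ... | inj₂ (c , cyc , c<xs) = inj₂ (c , cyc , m<n⇒m<1+n c<xs)
  ... | inj₁ u with x ∈ⱽ? xs
  ...   | no  x∉ = inj₁ (All.tabulate (λ y∈ x≡y → x∉ (subst (_∈ xs) (sym x≡y) y∈)) ∷ u)
  ...   | yes x∈ with ∈-∃++ x∈
  ...     | B , C , refl = inj₂ (x ∷ B , (unique , three≤ B lk nb , closed) , shorter)
    where
    unique : Unique (x ∷ B)
    unique = All.tabulate (λ y∈ x≡y → Unique-++-∉ˡ B u (subst (_∈ B) (sym x≡y) y∈)) ∷ Unique-++⁻ˡ B u
    three≤ : ∀ B → Linked (E G) (x ∷ B ++ x ∷ C) → NonBacktracking (x ∷ B ++ x ∷ C) →
             3 ≤ length (x ∷ B)
    three≤ []          (Exx ∷ _) _        = contradiction Exx (Graph.irrefl G x)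
    three≤ (_ ∷ [])    _         (x≢x , _) = contradiction refl x≢x
    three≤ (_ ∷ _ ∷ _) _         _        = s≤s (s≤s (s≤s z≤n))
    closed : Linked (E G) (x ∷ B ++ [ x ])
    closed = Linked-++⁻ˡ (x ∷ B ++ [ x ]) (subst (Linked (E G)) (cong (x ∷_) (sym (++-assoc B [ x ] C))) lk)
    shorter : length (x ∷ B) < length (x ∷ B ++ x ∷ C)
    shorter = s≤s (subst (length B <_) (sym (length-++ B)) (m<m+n (length B) (s≤s z≤n)))

  short-nonBacktracking-unique : ∀ {g} → GirthGreaterThan G g → ∀ xs → Linked (E G) xs → NonBacktracking xs →
                                 length xs ≤ suc g → Unique xs
  short-nonBacktracking-unique girth xs lk nb xs≤ with cycle-or-unique xs lk nb
  ... | inj₁ u              = u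
  ... | inj₂ (c , cyc , c<) = contradiction (≤-trans (girth c cyc) (≤-pred (≤-trans c< xs≤))) (<-irrefl refl)

module RegularTree (d : ℕ) where

  Word : Set
  Word = List (Fin d)

  -- Words name the vertices of the d-regular tree by their path from the root.
  treeDist : Word → Word → ℕ
  treeDist []      w       = length w
  treeDist (a ∷ c) []      = length (a ∷ c)
  treeDist (a ∷ c) (b ∷ w) with a Fin.≟ b
  ... | yes _ = treeDist c w
  ... | no  _ = length (a ∷ c) + length (b ∷ w)

  treeDist-∷ : ∀ a c w → treeDist (a ∷ c) (a ∷ w) ≡ treeDist c w
  treeDist-∷ a c w with a Fin.≟ a
  ... | yes _   = refl
  ... | no  a≢a = contradiction refl a≢a

  treeDist-≢ : ∀ {a b} c w → a ≢ b → treeDist (a ∷ c) (b ∷ w) ≡ length (a ∷ c) + length (b ∷ w)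
  treeDist-≢ {a} {b} c w a≢b with a Fin.≟ b
  ... | yes a≡b = contradiction a≡b a≢b
  ... | no  _   = refl

  treeDist-self : ∀ c → treeDist c c ≡ 0
  treeDist-self []      = refl
  treeDist-self (a ∷ c) = trans (treeDist-∷ a c c) (treeDist-self c)

  treeDist-[]ʳ : ∀ c → treeDist c [] ≡ length c
  treeDist-[]ʳ []      = refl
  treeDist-[]ʳ (_ ∷ _) = refl

  treeDist-sym : ∀ c w → treeDist c w ≡ treeDist w c
  treeDist-sym []      w       = sym (treeDist-[]ʳ w)
  treeDist-sym (a ∷ c) []      = refl
  treeDist-sym (a ∷ c) (b ∷ w) with a Fin.≟ b
  ... | yes refl = trans (treeDist-sym c w) (sym (treeDist-∷ a w c))
  ... | no  a≢b  = trans (+-comm (length (a ∷ c)) _) (sym (treeDist-≢ w c (a≢b ∘ sym)))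

  treeDist≤length+length : ∀ c w → treeDist c w ≤ length c + length w
  treeDist≤length+length []      w       = ≤-refl
  treeDist≤length+length (a ∷ c) []      = m≤m+n _ 0
  treeDist≤length+length (a ∷ c) (b ∷ w) with a Fin.≟ b
  ... | yes refl =
    ≤-trans (treeDist≤length+length c w) (≤-trans (n≤1+n _) (s≤s (+-monoʳ-≤ (length c) (n≤1+n _))))
  ... | no  _    = ≤-refl

  length≤length+treeDist : ∀ c w → length w ≤ length c + treeDist c w
  length≤length+treeDist []      w       = ≤-refl
  length≤length+treeDist (a ∷ c) []      = z≤n
  length≤length+treeDist (a ∷ c) (b ∷ w) with a Fin.≟ b
  ... | yes refl = s≤s (length≤length+treeDist c w)
  ... | no  _    = ≤-trans (m≤n+m _ (length (a ∷ c))) (+-monoʳ-≤ (length (a ∷ c)) (m≤n+m _ (length (a ∷ c))))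

  length≤treeDist+length : ∀ c w → length c ≤ treeDist c w + length w
  length≤treeDist+length c w =
    subst (length c ≤_) (trans (+-comm (length w) _) (cong (_+ length w) (treeDist-sym w c)))
          (length≤length+treeDist w c)

  treeDist-triangle : ∀ u v w → treeDist u w ≤ treeDist u v + treeDist v w
  treeDist-triangle []      v       w       = length≤length+treeDist v w
  treeDist-triangle (a ∷ u) []      w       = treeDist≤length+length (a ∷ u) w
  treeDist-triangle (a ∷ u) (b ∷ v) []      = length≤treeDist+length (a ∷ u) (b ∷ v)
  treeDist-triangle (a ∷ u) (b ∷ v) (c ∷ w) with a Fin.≟ b | b Fin.≟ c
  ... | yes refl | yes refl = begin
    treeDist (a ∷ u) (a ∷ w)             ≡⟨ treeDist-∷ a u w ⟩
    treeDist u w                         ≤⟨ treeDist-triangle u v w ⟩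
    treeDist u v + treeDist v w          ∎
    where open ≤-Reasoning
  ... | yes refl | no  a≢c  = begin
    treeDist (a ∷ u) (c ∷ w)             ≡⟨ treeDist-≢ u w a≢c ⟩
    suc (length u) + length (c ∷ w)      ≤⟨ +-monoˡ-≤ (length (c ∷ w)) (s≤s (length≤treeDist+length u v)) ⟩
    suc (treeDist u v + length v) + length (c ∷ w)   ≡⟨ shift (treeDist u v) _ _ ⟩
    treeDist u v + (length (a ∷ v) + length (c ∷ w)) ∎
    where
    open ≤-Reasoning
    shift : ∀ x y z → suc (x + y) + z ≡ x + (suc y + z)
    shift = solve-∀
  ... | no  a≢b  | yes refl = begin
    treeDist (a ∷ u) (b ∷ w)             ≡⟨ treeDist-≢ u w a≢b ⟩
    length (a ∷ u) + suc (length w)      ≤⟨ +-monoʳ-≤ (length (a ∷ u)) (s≤s (length≤length+treeDist v w)) ⟩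
    length (a ∷ u) + (length (b ∷ v) + treeDist v w)   ≡⟨ +-assoc (length (a ∷ u)) _ _ ⟨
    length (a ∷ u) + length (b ∷ v) + treeDist v w     ∎
    where open ≤-Reasoning
  ... | no  _    | no  _    = begin
    treeDist (a ∷ u) (c ∷ w)             ≤⟨ treeDist≤length+length (a ∷ u) (c ∷ w) ⟩
    length (a ∷ u) + length (c ∷ w)
      ≤⟨ +-mono-≤ (m≤m+n (length (a ∷ u)) _) (m≤n+m (length (c ∷ w)) (length (b ∷ v))) ⟩
    length (a ∷ u) + length (b ∷ v) + (length (b ∷ v) + length (c ∷ w)) ∎
    where open ≤-Reasoning

  -- k is the number of admissible first letters: d at the root, d ∸ 1 below it.
  -- intersectionCount k l p q counts the reduced words of length p at tree distance q
  -- from a fixed reduced word of length l.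
  reducedCount : ℕ → ℕ → ℕ
  reducedCount k zero    = 1
  reducedCount k (suc p) = k * reducedCount (d ∸ 1) p

  intersectionCount : ℕ → ℕ → ℕ → ℕ → ℕ
  intersectionCount k zero    p       q = 𝟙 (p ≟ q) * reducedCount k p
  intersectionCount k (suc l) zero    q = 𝟙 (q ≟ suc l)
  intersectionCount k (suc l) (suc p) q =
    intersectionCount (d ∸ 1) l p q + (k ∸ 1) * (𝟙 (q ≟ suc l + suc p) * reducedCount (d ∸ 1) p)

module LargeGirth (G : Graph) {d} (reg : IsRegular (E G) d) where

  open Walks G
  open RegularTree d

  private
    V = Fin (Graph.n G)

  neighbour : V → Fin d → V
  neighbour v = enumerate (reg v)

  neighbour-adj : ∀ v a → E G v (neighbour v a)
  neighbour-adj v = enumerate-sound (reg v)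

  neighbour-injective : ∀ v a b → neighbour v a ≡ neighbour v b → a ≡ b
  neighbour-injective v = enumerate-injective (reg v)

  neighbour-surjective : ∀ {v y} → E G v y → ∃ λ a → neighbour v a ≡ y
  neighbour-surjective {v} = enumerate-surjective (reg v)

  endpoint : V → Word → V
  endpoint v []      = v
  endpoint v (a ∷ w) = endpoint (neighbour v a) w

  Avoids : Maybe V → V → Set
  Avoids nothing  _ = ⊤
  Avoids (just u) y = u ≢ y

  -- Reduced v parent w: the walk spelled by w from v never steps back to the
  -- vertex it just came from, the first step avoiding parent.
  Reduced : V → Maybe V → Word → Set
  Reduced v parent []      = ⊤
  Reduced v parent (a ∷ w) = Avoids parent (neighbour v a) × Reduced (neighbour v a) (just v) w

  walkAlong : ∀ v w → Walk G v (endpoint v w) (length w)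
  walkAlong v []      = here v
  walkAlong v (a ∷ w) = step (neighbour-adj v a) (walkAlong (neighbour v a) w)

  walkBetween : ∀ v c w → Walk G (endpoint v c) (endpoint v w) (treeDist c w)
  walkBetween v []      w       = walkAlong v w
  walkBetween v (a ∷ c) []      = reverseʷ (walkAlong v (a ∷ c))
  walkBetween v (a ∷ c) (b ∷ w) with a Fin.≟ b
  ... | yes refl = walkBetween (neighbour v a) c w
  ... | no  _    = reverseʷ (walkAlong v (a ∷ c)) ++ʷ walkAlong v (b ∷ w)

  avoids? : ∀ parent y → Avoids parent y ⊎ parent ≡ just y
  avoids? nothing  y = inj₁ tt
  avoids? (just u) y with u Fin.≟ y
  ... | yes refl = inj₂ refl
  ... | no  u≢y  = inj₁ u≢y

  neighbour-endpoint : ∀ {v parent} c {y} → Reduced v parent c → E G (endpoint v c) y →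
                       (∃ λ c' → Reduced v parent c' × endpoint v c' ≡ y × treeDist c c' ≡ 1)
                       ⊎ (c ≡ [] × parent ≡ just y)
  neighbour-endpoint {v} {parent} [] _ Ey with neighbour-surjective Ey
  ... | a , refl with avoids? parent (neighbour v a)
  ...   | inj₁ avoids  = inj₁ ([ a ] , (avoids , tt) , refl , refl)
  ...   | inj₂ parent≡ = inj₂ (refl , parent≡)
  neighbour-endpoint {v} (a ∷ c) (avoids , Rc) Ey with neighbour-endpoint c Rc Ey
  ... | inj₁ (c' , Rc' , eq , dist1) = inj₁ (a ∷ c' , (avoids , Rc') , eq , trans (treeDist-∷ a c c') dist1)
  ... | inj₂ (refl , refl)           = inj₁ ([] , tt , refl , refl)

  liftWalk : ∀ {x} c → Reduced x nothing c → ∀ {z s} → Walk G (endpoint x c) z s →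
             ∃ λ w → Reduced x nothing w × endpoint x w ≡ z × treeDist c w ≤ s
  liftWalk c Rc (here _) = c , Rc , refl , ≤-reflexive (treeDist-self c)
  liftWalk c Rc (step {k = s} e p) with neighbour-endpoint c Rc e
  ... | inj₂ (_ , ())
  ... | inj₁ (c' , Rc' , refl , dist1) with liftWalk c' Rc' p
  ...   | w , Rw , eq , c'w≤s = w , Rw , eq , (begin
    treeDist c w                  ≤⟨ treeDist-triangle c c' w ⟩
    treeDist c c' + treeDist c' w ≡⟨ cong (_+ treeDist c' w) dist1 ⟩
    suc (treeDist c' w)           ≤⟨ s≤s c'w≤s ⟩
    suc s                         ∎)
    where open ≤-Reasoning

  trail : V → Word → List V
  trail v []      = []
  trail v (a ∷ w) = neighbour v a ∷ trail (neighbour v a) w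

  -- climb v w acc = reverse (v ∷ trail v w) ++ acc
  climb : V → Word → List V → List V
  climb v []      acc = v ∷ acc
  climb v (a ∷ w) acc = climb (neighbour v a) w (v ∷ acc)

  trail-linked : ∀ v w → Linked (E G) (v ∷ trail v w)
  trail-linked v []      = [-]
  trail-linked v (a ∷ w) = neighbour-adj v a ∷ trail-linked (neighbour v a) w

  trail-nonBacktracking : ∀ {u v} w → Reduced v (just u) w → NonBacktracking (u ∷ v ∷ trail v w)
  trail-nonBacktracking []      _         = tt
  trail-nonBacktracking (a ∷ w) (u≢ , Rw) = u≢ , trail-nonBacktracking w Rw

  endpoint∈trail : ∀ v a w → endpoint v (a ∷ w) ∈ trail v (a ∷ w)
  endpoint∈trail v a []      = here refl
  endpoint∈trail v a (b ∷ w) = there (endpoint∈trail (neighbour v a) b w)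

  length-trail : ∀ v w → length (trail v w) ≡ length w
  length-trail v []      = refl
  length-trail v (a ∷ w) = cong suc (length-trail (neighbour v a) w)

  climb-linked : ∀ {v} w {acc} → Linked (E G) (v ∷ acc) → Linked (E G) (climb v w acc)
  climb-linked     []      lk = lk
  climb-linked {v} (a ∷ w) lk = climb-linked w (Graph.sym G (neighbour-adj v a) ∷ lk)

  climb-nonBacktracking : ∀ {v} w {acc} → NonBacktracking (v ∷ acc) → Reduced v (List.head acc) w →
                          NonBacktracking (climb v w acc)
  climb-nonBacktracking []                nb _          = nb
  climb-nonBacktracking (a ∷ w) {[]}      nb (_  , Rw)  = climb-nonBacktracking w tt Rw
  climb-nonBacktracking (a ∷ w) {u ∷ acc} nb (u≢ , Rw)  = climb-nonBacktracking w (u≢ ∘ sym , nb) Rw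

  climb-unique : ∀ {v} w {acc} → Unique (climb v w acc) → endpoint v w ∉ acc
  climb-unique []      (v∉ ∷ _) v∈ = All.lookup v∉ v∈ refl
  climb-unique (a ∷ w) u        e∈ = climb-unique w u (there e∈)

  length-climb : ∀ {v} w acc → length (climb v w acc) ≡ suc (length w + length acc)
  length-climb []      acc = refl
  length-climb (a ∷ w) acc = trans (length-climb w _) (cong suc (+-suc (length w) (length acc)))

  module _ {g} (girth : GirthGreaterThan G g) where

    -- Following c upwards to v and then b ∷ w downwards is a short
    -- non-backtracking walk, so it cannot revisit a vertex.
    fork-endpoints-≢ : ∀ {v} c {b} w → Reduced v (just (neighbour v b)) c → Reduced (neighbour v b) (just v) w →
                       length c + length (b ∷ w) ≤ g → endpoint v c ≢ endpoint v (b ∷ w)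
    fork-endpoints-≢ {v} c {b} w Rc Rw c+bw≤g eq =
      climb-unique c (short-nonBacktracking-unique girth walk linked nonBacktracking walk≤)
                     (subst (_∈ trail v (b ∷ w)) (sym eq) (endpoint∈trail v b w))
      where
      walk : List V
      walk = climb v c (trail v (b ∷ w))
      linked : Linked (E G) walk
      linked = climb-linked c (trail-linked v (b ∷ w))
      nonBacktracking : NonBacktracking walk
      nonBacktracking = climb-nonBacktracking c (trail-nonBacktracking w Rw) Rc
      walk≤ : length walk ≤ suc g
      walk≤ = subst (_≤ suc g)
                (sym (trans (length-climb c _) (cong (λ t → suc (length c + t)) (length-trail v (b ∷ w)))))
                (s≤s c+bw≤g)

    reduced-injective : ∀ {v parent} c w → Reduced v parent c → Reduced v parent w →
                        endpoint v c ≡ endpoint v w → treeDist c w ≤ g → c ≡ w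
    reduced-injective []      []      _        _        _  _     = refl
    reduced-injective []      (b ∷ w) _        (_ , Rw) eq short =
      contradiction eq (fork-endpoints-≢ [] w tt Rw short)
    reduced-injective (a ∷ c) []      (_ , Rc) _        eq short =
      contradiction (sym eq) (fork-endpoints-≢ [] c tt Rc short)
    reduced-injective {v} (a ∷ c) (b ∷ w) (_ , Rc) (_ , Rw) eq short with a Fin.≟ b
    ... | yes refl = cong (a ∷_) (reduced-injective c w Rc Rw eq short)
    ... | no  a≢b  =
      contradiction eq (fork-endpoints-≢ (a ∷ c) w ((λ e → a≢b (neighbour-injective v a b (sym e))) , Rc) Rw short)

  ParentAdj : V → Maybe V → Set
  ParentAdj v nothing  = ⊤
  ParentAdj v (just u) = E G v u

  branching : Maybe V → ℕ
  branching nothing  = d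
  branching (just _) = d ∸ 1

  countLetters : ∀ {v parent} → ParentAdj v parent →
                 ExactlyN (λ a → Avoids parent (neighbour v a)) (branching parent)
  countLetters {parent = nothing} _   = ExactlyN-Fin
  countLetters {v} {just u}       Evu with neighbour-surjective Evu
  ... | k , refl = ExactlyN-cong
    (λ a → mk⇔ (λ a≢k e → a≢k (neighbour-injective v a k (sym e)))
               (λ u≢ a≡k → u≢ (cong (neighbour v) (sym a≡k))))
    refl (ExactlyN-≢ k)

  ReducedOfLength : V → Maybe V → ℕ → Word → Set
  ReducedOfLength v parent p w = Reduced v parent w × length w ≡ p

  child-adj : ∀ v a → ParentAdj (neighbour v a) (just v)
  child-adj v a = Graph.sym G (neighbour-adj v a)

  countReduced : ∀ {v parent} → ParentAdj v parent → ∀ p →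
                 ExactlyN (ReducedOfLength v parent p) (reducedCount (branching parent) p)
  countReduced _ zero = ExactlyN-singleton []
    (λ { [] → mk⇔ (λ _ → refl) (λ _ → tt , refl) ; (a ∷ w) → mk⇔ (λ { (_ , ()) }) (λ ()) })
  countReduced {v} adj (suc p) = ExactlyN-cong
    (λ { [] → mk⇔ (λ ()) (λ { (_ , ()) })
       ; (a ∷ w) → mk⇔ (λ (avoids , Rw , len) → (avoids , Rw) , cong suc len)
                       (λ ((avoids , Rw) , len) → avoids , Rw , suc-injective len) })
    refl
    (ExactlyN-◃ (countLetters adj) (λ {a} _ → countReduced (child-adj v a) p))

  AtDistance : V → Maybe V → Word → ℕ → ℕ → Word → Set
  AtDistance v parent c p q w = ReducedOfLength v parent p w × treeDist c w ≡ q

  countAtDistance : ∀ {v parent} → ParentAdj v parent → ∀ c → Reduced v parent c → ∀ p q →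
                    ExactlyN (AtDistance v parent c p q) (intersectionCount (branching parent) (length c) p q)
  countAtDistance adj [] _ p q = ExactlyN-cong
    (λ w → mk⇔ (λ ((Rw , len) , p≡q) → (Rw , len) , trans len p≡q)
               (λ ((Rw , len) , dist) → (Rw , len) , trans (sym len) dist))
    refl (ExactlyN-guard (p ≟ q) (countReduced adj p))
  countAtDistance adj (b ∷ c) _ zero q = ExactlyN-cong
    (λ { [] → mk⇔ (λ (_ , q≡) → (tt , refl) , sym q≡) (λ (_ , dist) → refl , sym dist)
       ; (a ∷ w) → mk⇔ (λ { (() , _) }) (λ { ((_ , ()) , _) }) })
    (*-identityʳ _)
    (ExactlyN-guard (q ≟ suc (length c)) (ExactlyN-singleton [] (λ _ → mk⇔ id id)))
  countAtDistance {v} {parent} adj (b ∷ c) (b-avoids , Rc) (suc p) q =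
    ExactlyN-cong split refl (ExactlyN-⊎ disjoint sameBranch otherBranches)
    where
    SameBranch OtherBranches : Word → Set
    SameBranch = (_≡ b) ◃ λ _ → AtDistance (neighbour v b) (just v) c p q
    OtherBranches = (λ a → Avoids parent (neighbour v a) × a ≢ b)
                  ◃ λ a w → ReducedOfLength (neighbour v a) (just v) p w × q ≡ suc (length c) + suc p

    sameBranch : ExactlyN SameBranch (intersectionCount (d ∸ 1) (length c) p q)
    sameBranch = ExactlyN-cong
      (λ { [] → mk⇔ (λ { (_ , _ , ()) }) (λ ())
         ; (a ∷ w) → mk⇔ (λ { (w , AD , refl) → refl , AD }) (λ { (refl , AD) → w , AD , refl }) })
      refl
      (ExactlyN-image (b ∷_) (λ _ _ → ∷-injectiveʳ) (λ _ → mk⇔ id id)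
                      (countAtDistance (child-adj v b) c Rc p q))

    otherBranches : ExactlyN OtherBranches
                      ((branching parent ∸ 1) * (𝟙 (q ≟ suc (length c) + suc p) * reducedCount (d ∸ 1) p))
    otherBranches = ExactlyN-◃ (ExactlyN-remove Fin._≟_ (countLetters adj) b-avoids)
                               (λ {a} _ → ExactlyN-guard (q ≟ _) (countReduced (child-adj v a) p))

    disjoint : ∀ {w} → SameBranch w → ¬ OtherBranches w
    disjoint {_ ∷ _} (a≡b , _) ((_ , a≢b) , _) = a≢b a≡b

    split : ∀ w → (SameBranch w ⊎ OtherBranches w) ⇔ AtDistance v parent (b ∷ c) (suc p) q w
    split [] = mk⇔ (λ { (inj₁ ()) ; (inj₂ ()) }) (λ { ((_ , ()) , _) })
    split (a ∷ w) = mk⇔ to′ from′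
      where
      to′ : SameBranch (a ∷ w) ⊎ OtherBranches (a ∷ w) → AtDistance v parent (b ∷ c) (suc p) q (a ∷ w)
      to′ (inj₁ (refl , (Rw , len) , dist)) = ((b-avoids , Rw) , cong suc len) , trans (treeDist-∷ a c w) dist
      to′ (inj₂ ((avoids , a≢b) , (Rw , len) , q≡)) = ((avoids , Rw) , cong suc len) ,
        trans (treeDist-≢ c w (a≢b ∘ sym)) (trans (cong (λ t → suc (length c) + suc t) len) (sym q≡))
      from′ : AtDistance v parent (b ∷ c) (suc p) q (a ∷ w) → SameBranch (a ∷ w) ⊎ OtherBranches (a ∷ w)
      from′ (((avoids , Rw) , len) , dist) with a Fin.≟ b
      ... | yes refl = inj₁ (refl , (Rw , suc-injective len) , trans (sym (treeDist-∷ a c w)) dist)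
      ... | no  a≢b  = inj₂ ((avoids , a≢b) , (Rw , suc-injective len) ,
          trans (sym dist) (trans (treeDist-≢ c w (a≢b ∘ sym))
                                  (cong (λ t → suc (length c) + suc t) (suc-injective len))))

  module _ (M : ℕ) (girth : GirthGreaterThan G (3 * M)) where

    private
      sum≤3M : ∀ {a b c} → a ≤ M → b ≤ M → c ≤ M → a + b + c ≤ 3 * M
      sum≤3M {a} {b} {c} a≤ b≤ c≤ = subst (a + b + c ≤_) (triple M) (+-mono-≤ (+-mono-≤ a≤ b≤) c≤)
        where
        triple : ∀ m → m + m + m ≡ 3 * m
        triple = solve-∀

    -- A short walk lifts to a reduced word with the same endpoint as w, hence to w itself.
    treeDist≤walk : ∀ {x} c w → Reduced x nothing c → Reduced x nothing w → length c ≤ M → length w ≤ M →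
                    ∀ {j} → Walk G (endpoint x c) (endpoint x w) j → j ≤ M → treeDist c w ≤ j
    treeDist≤walk c w Rc Rw c≤M w≤M walk j≤M with liftWalk c Rc walk
    ... | w' , Rw' , endpoint≡ , cw'≤j with reduced-injective girth w w' Rw Rw' (sym endpoint≡) ww'≤3M
      where
      ww'≤3M : treeDist w w' ≤ 3 * M
      ww'≤3M = begin
        treeDist w w'                 ≤⟨ treeDist-triangle w c w' ⟩
        treeDist w c + treeDist c w'  ≤⟨ +-monoʳ-≤ (treeDist w c) cw'≤j ⟩
        treeDist w c + _              ≤⟨ +-monoˡ-≤ _ (treeDist≤length+length w c) ⟩
        length w + length c + _       ≤⟨ sum≤3M w≤M c≤M j≤M ⟩
        3 * M                         ∎
        where open ≤-Reasoning
    ... | refl = cw'≤j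

    Dist⇔treeDist : ∀ {x} c w → Reduced x nothing c → Reduced x nothing w → length c ≤ M → length w ≤ M →
                    ∀ {q} → q ≤ M → Dist G (endpoint x c) (endpoint x w) q ⇔ treeDist c w ≡ q
    Dist⇔treeDist {x} c w Rc Rw c≤M w≤M {q} q≤M = mk⇔
      (λ (walk , minimal) →
         ≤-antisym (treeDist≤walk c w Rc Rw c≤M w≤M walk q≤M) (minimal _ (walkBetween x c w)))
      (λ dist≡q → subst (Dist G _ _) dist≡q (walkBetween x c w , minimal (subst (_≤ M) (sym dist≡q) q≤M)))
      where
      minimal : treeDist c w ≤ M → ∀ j → Walk G (endpoint x c) (endpoint x w) j → treeDist c w ≤ j
      minimal dist≤M j walk with j ≤? M
      ... | yes j≤M = treeDist≤walk c w Rc Rw c≤M w≤M walk j≤M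
      ... | no  j≰M = ≤-trans dist≤M (<⇒≤ (≰⇒> j≰M))

    representative : ∀ {x z p} → p ≤ M → Dist G x z p →
                     ∃ λ w → ReducedOfLength x nothing p w × endpoint x w ≡ z
    representative {x} p≤M (walk , minimal) with liftWalk [] tt walk
    ... | w , Rw , refl , w≤p =
      w , (Rw , to (Dist⇔treeDist [] w tt Rw z≤n (≤-trans w≤p p≤M) p≤M) (walk , minimal)) , refl

    endpoint-injective : ∀ {x w w'} → Reduced x nothing w → Reduced x nothing w' →
                         length w ≤ M → length w' ≤ M → endpoint x w ≡ endpoint x w' → w ≡ w'
    endpoint-injective {w = w} {w'} Rw Rw' w≤M w'≤M eq = reduced-injective girth w w' Rw Rw' eq
      (≤-trans (treeDist≤length+length w w') (≤-trans (m≤m+n _ 0) (sum≤3M w≤M w'≤M z≤n)))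

    distance-regular : DistanceRegularUpTo (Dist G) M (λ l (p , q) → intersectionCount d l p q)
    distance-regular = record
      { functional   = Dist-functional
      ; reflexive    = Dist-refl
      ; intersection = intersection
      }
      where
      intersection : ∀ {x y l} → Dist G x y l → l ≤ M → ∀ {p q} → p ≤ M → q ≤ M →
                     ExactlyN (λ z → Dist G x z p × Dist G y z q) (intersectionCount d l p q)
      intersection {x} y-at-l l≤M {p} {q} p≤M q≤M with representative l≤M y-at-l
      ... | c , (Rc , refl) , refl = ExactlyN-image (endpoint x)
        (λ ((Rw , w≡p) , _) ((Rw' , w'≡p) , _) →
           endpoint-injective Rw Rw' (subst (_≤ M) (sym w≡p) p≤M) (subst (_≤ M) (sym w'≡p) p≤M))
        inBoth
        (countAtDistance tt c Rc p q)
        where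
        inBoth : ∀ z → (Dist G x z p × Dist G (endpoint x c) z q) ⇔
                       ∃ λ w → AtDistance x nothing c p q w × endpoint x w ≡ z
        inBoth z = mk⇔
          (λ (x-z , y-z) → let (w , (Rw , w≡p) , eq) = representative p≤M x-z
                               w≤M = subst (_≤ M) (sym w≡p) p≤M in
             w , ((Rw , w≡p) , to (Dist⇔treeDist c w Rc Rw l≤M w≤M q≤M) (subst (λ t → Dist G _ t q) (sym eq) y-z)) ,
             eq)
          (λ { (w , ((Rw , w≡p) , dist) , refl) → let w≤M = subst (_≤ M) (sym w≡p) p≤M in
             from (Dist⇔treeDist [] w tt Rw z≤n w≤M p≤M) w≡p ,
             from (Dist⇔treeDist c w Rc Rw l≤M w≤M q≤M) dist })

≤-maxList : ∀ S → All (_≤ maxList S) S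
≤-maxList []      = []
≤-maxList (x ∷ S) =
  m≤m⊔n x (maxList S) ∷ All.map (λ y≤ → ≤-trans y≤ (m≤n⊔m x (maxList S))) (≤-maxList S)

claim3p1 : (d : ℕ) → 3 ≤ d → (S : List ℕ) →
    Σ ℕ λ a → Σ ℕ λ b →
      (G : Graph) → IsRegular (E G) d → GirthGreaterThan G (3 * maxList S) →
      IsABRegular (PolyAdj G S) a b
claim3p1 d _ S =
  commonCount (toList (Vec.replicate (length S) 0)) (S , S) ,
  commonCount S (S , S) ,
  λ G reg girth → Polygraph.polygraph-regular (Dist G) (LargeGirth.distance-regular G reg M girth) S (≤-maxList S)
  where
  M : ℕ
  M = maxList S
  open CommonCount M (λ l (p , q) → RegularTree.intersectionCount d d l p q)
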